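{- Let $(V,E)$ be an interval graph, $W=\{(a,b)\in V\times V\mid\neg\,a\,E\,b\}$, and $(a,b)\,Q\,(c,d)$ iff $a\,E\,c$ and $b\,E\,d$. If the graph $(W,Q)$ has exactly two connected components, then $(V,E)$ is uniquely orderable.
   Context: A graph $(V,E)$ has $E$ symmetric. An interval graph is a reflexive graph for which there exist a linear order $L$ and an assignment of a nonempty interval $F(v)\subseteq L$ to each vertex with $v\,E\,u\iff F(v)\cap F(u)\ne\emptyset$. A strict partial order $\prec$ is associated to $(V,E)$ if $\neg\,u\,E\,v$ iff ($u\prec v$ or $v\prec u$); $(V,E)$ is uniquely orderable if it has an associated order and the only other associated order is its dual. -}

module Defs where

open import Level using (0ℓ)
open import Data.Product using (Σ; ∃; _×_; _,_; proj₁; proj₂)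
open import Data.Sum using (_⊎_)
open import Relation.Nullary using (¬_)
open import Relation.Binary.Core using (Rel)
open import Relation.Binary.Definitions using (Reflexive; Symmetric; Transitive; Irreflexive)
open import Relation.Binary.PropositionalEquality using (_≡_)
open import Relation.Binary.Bundles using (TotalOrder)
open import Relation.Binary.Construct.Closure.Equivalence using (EqClosure)

IsGraph : {V : Set} → Rel V 0ℓ → Set
IsGraph E = Symmetric E

IsInterval : (L : TotalOrder 0ℓ 0ℓ 0ℓ) → (TotalOrder.Carrier L → Set) → Set
IsInterval L I =
  (∃ λ x → I x) ×
  (∀ x y z → I x → I z → x ≤ y → y ≤ z → I y)
  where open TotalOrder L

IsIntervalGraph : {V : Set} → Rel V 0ℓ → Set₁
IsIntervalGraph {V} E =
  Reflexive E ×
  Σ (TotalOrder 0ℓ 0ℓ 0ℓ) λ L →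
  Σ (V → TotalOrder.Carrier L → Set) λ F →
    (∀ v → IsInterval L (F v)) ×
    (∀ v u → (E v u → ∃ λ x → F v x × F u x) × ((∃ λ x → F v x × F u x) → E v u))

IsStrictPartialOrder : {V : Set} → Rel V 0ℓ → Set
IsStrictPartialOrder _≺_ = Irreflexive _≡_ _≺_ × Transitive _≺_

IsAssociated : {V : Set} → Rel V 0ℓ → Rel V 0ℓ → Set
IsAssociated {V} E _≺_ =
  IsStrictPartialOrder _≺_ ×
  (∀ u v → (¬ E u v → (u ≺ v ⊎ v ≺ u)) × ((u ≺ v ⊎ v ≺ u) → ¬ E u v))

SameRel : {V : Set} → Rel V 0ℓ → Rel V 0ℓ → Set
SameRel R S = ∀ u v → (R u v → S u v) × (S u v → R u v)

Dual : {V : Set} → Rel V 0ℓ → Rel V 0ℓ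
Dual R u v = R v u

UniquelyOrderable : {V : Set} → Rel V 0ℓ → Set₁
UniquelyOrderable {V} E =
  Σ (Rel V 0ℓ) λ ≺ →
    IsAssociated E ≺ ×
    (∀ (≺' : Rel V 0ℓ) → IsAssociated E ≺' → SameRel ≺' ≺ ⊎ SameRel ≺' (Dual ≺))

W : {V : Set} → Rel V 0ℓ → Set
W {V} E = Σ (V × V) λ p → ¬ E (proj₁ p) (proj₂ p)

Q : {V : Set} (E : Rel V 0ℓ) → Rel (W E) 0ℓ
Q E ((a , b) , _) ((c , d) , _) = E a c × E b d

Connected : {V : Set} (E : Rel V 0ℓ) → Rel (W E) 0ℓ
Connected E = EqClosure (Q E)

ExactlyTwoComponents : {V : Set} → Rel V 0ℓ → Set
ExactlyTwoComponents E =
  Σ (W E) λ w₁ → Σ (W E) λ w₂ →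
    ¬ Connected E w₁ w₂ × (∀ w → Connected E w₁ w ⊎ Connected E w₂ w)

{-# OPTIONS --safe #-}
module Submission where

open import Defs
open import Level using (0ℓ)
open import Relation.Binary.Core using (Rel)
open import Relation.Binary.Definitions using (Symmetric)
open import Relation.Binary.Bundles using (TotalOrder)
open import Relation.Binary.PropositionalEquality using (refl)
open import Relation.Binary.Construct.Closure.ReflexiveTransitive using (ε; _◅_)
open import Relation.Binary.Construct.Closure.Symmetric using (fwd; bwd)
import Relation.Binary.Construct.Closure.Equivalence as EqClosure
open import Data.Product using (∃; _×_; _,_; proj₁; proj₂)
open import Data.Sum using (_⊎_; inj₁; inj₂)
open import Data.Empty using (⊥; ⊥-elim)
open import Relation.Nullary using (¬_)

-- An interval representation yields an associated order (u ≺ v when the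
-- interval of u lies left of that of v), so it suffices to show that every associated
-- order S equals ≺ or its dual.  Since an interval graph has no induced 4-cycle, Q never
-- joins a pair oriented one way by S to a pair oriented the other way, so the
-- S-orientation of a pair in W is constant on components.  Swapping the coordinates maps
-- each component to one that reverses every orientation, hence to the other component;
-- so S is determined by how it orients a single pair.

InducedC4Free : {V : Set} → Rel V 0ℓ → Set
InducedC4Free E =
  ∀ {a b c d} → E a b → E b c → E c d → E d a → ¬ E a c → ¬ E b d → ⊥

Dual-associated : {V : Set} {E S : Rel V 0ℓ} → Symmetric E →
  IsAssociated E S → IsAssociated E (Dual S)
Dual-associated E-sym ((irrefl , trans) , iff) =
  ((λ { refl → irrefl refl }) , (λ s t → trans t s)) ,
  λ u v → (λ ¬e → proj₁ (iff v u) (λ e → ¬e (E-sym e))) ,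
          (λ s e → proj₂ (iff v u) s (E-sym e))

SameRel-swap : {V : Set} {R S : Rel V 0ℓ} → SameRel (Dual R) S → SameRel R (Dual S)
SameRel-swap same u v = same v u

module IntervalOrder
  {V : Set} {E : Rel V 0ℓ} (E-sym : Symmetric E) (L : TotalOrder 0ℓ 0ℓ 0ℓ)
  {F : V → TotalOrder.Carrier L → Set} (intervals : ∀ v → IsInterval L (F v))
  (represents : ∀ v u → (E v u → ∃ λ x → F v x × F u x) × ((∃ λ x → F v x × F u x) → E v u))
  where

  open TotalOrder L using (Carrier; _≤_; total; trans)

  convex : ∀ {v x y z} → F v x → F v z → x ≤ y → y ≤ z → F v y
  convex {v} {x} {y} {z} = proj₂ (intervals v) x y z

  common-point : ∀ {u v} → E u v → ∃ λ x → F u x × F v x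
  common-point {u} {v} = proj₁ (represents u v)

  meet : ∀ {u v x} → F u x → F v x → E u v
  meet {u} {v} {x} x∈u x∈v = proj₂ (represents u v) (x , x∈u , x∈v)

  record _≺_ (u v : V) : Set where
    constructor precedes
    field
      apart : ¬ E u v
      {p q} : Carrier
      p∈u   : F u p
      q∈v   : F v q
      p≤q   : p ≤ q

  ≺-separates : ∀ {u v x y} → u ≺ v → F u x → F v y → x ≤ y
  ≺-separates {x = x} {y} (precedes ¬e {p} p∈u q∈v p≤q) x∈u y∈v with total x y
  ... | inj₁ x≤y = x≤y
  ... | inj₂ y≤x with total p y
  ...   | inj₁ p≤y = ⊥-elim (¬e (meet (convex p∈u x∈u p≤y y≤x) y∈v))
  ...   | inj₂ y≤p = ⊥-elim (¬e (meet p∈u (convex y∈v q∈v y≤p p≤q)))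

  ≺-crossing : ∀ {a b c d} → a ≺ b → c ≺ d → E a d → E c b → ⊥
  ≺-crossing a≺b c≺d ad cb with common-point ad | common-point cb
  ... | p , p∈a , p∈d | q , q∈c , q∈b =
    _≺_.apart a≺b (meet (convex p∈a p∈a p≤q q≤p) q∈b)
    where
      p≤q : p ≤ q
      p≤q = ≺-separates a≺b p∈a q∈b
      q≤p : q ≤ p
      q≤p = ≺-separates c≺d q∈c p∈d

  ≺-trans : ∀ {u v w} → u ≺ v → v ≺ w → u ≺ w
  ≺-trans {v = v} u≺v@(precedes _ p∈u _ _) v≺w@(precedes _ _ q∈w _)
    with proj₁ (intervals v)
  ... | y , y∈v =
    precedes (λ uw → ≺-crossing u≺v v≺w uw (meet y∈v y∈v))
             p∈u q∈w (trans (≺-separates u≺v p∈u y∈v) (≺-separates v≺w y∈v q∈w))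

  ≺-associated : IsAssociated E _≺_
  ≺-associated =
    ((λ { refl u≺u → _≺_.apart u≺u (meet (_≺_.p∈u u≺u) (_≺_.p∈u u≺u)) }) , ≺-trans) ,
    λ u v → compare , apart-either
    where
      compare : ∀ {u v} → ¬ E u v → u ≺ v ⊎ v ≺ u
      compare {u} {v} ¬e with proj₁ (intervals u) | proj₁ (intervals v)
      ... | x , x∈u | y , y∈v with total x y
      ...   | inj₁ x≤y = inj₁ (precedes ¬e x∈u y∈v x≤y)
      ...   | inj₂ y≤x = inj₂ (precedes (λ e → ¬e (E-sym e)) y∈v x∈u y≤x)
      apart-either : ∀ {u v} → u ≺ v ⊎ v ≺ u → ¬ E u v
      apart-either (inj₁ u≺v) = _≺_.apart u≺v
      apart-either (inj₂ v≺u) e = _≺_.apart v≺u (E-sym e)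

  inducedC4Free : InducedC4Free E
  inducedC4Free {a} {b} {c} {d} ab bc cd da ¬ac ¬bd
    with proj₁ (proj₂ ≺-associated a c) ¬ac | proj₁ (proj₂ ≺-associated b d) ¬bd
  ... | inj₁ a≺c | inj₁ b≺d = ≺-crossing a≺c b≺d (E-sym da) bc
  ... | inj₁ a≺c | inj₂ d≺b = ≺-crossing a≺c d≺b ab (E-sym cd)
  ... | inj₂ c≺a | inj₁ b≺d = ≺-crossing c≺a b≺d cd (E-sym ab)
  ... | inj₂ c≺a | inj₂ d≺b = ≺-crossing c≺a d≺b (E-sym bc) da

Oriented : {V : Set} (E : Rel V 0ℓ) → Rel V 0ℓ → W E → Set
Oriented E S ((a , b) , _) = S a b

flipW : {V : Set} {E : Rel V 0ℓ} → Symmetric E → W E → W E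
flipW E-sym ((a , b) , ¬ab) = (b , a) , λ ba → ¬ab (E-sym ba)

module AssociatedOrder
  {V : Set} {E : Rel V 0ℓ} (E-sym : Symmetric E) (C4-free : InducedC4Free E)
  {S : Rel V 0ℓ} (S-associated : IsAssociated E S)
  where

  S-trans : ∀ {a b c} → S a b → S b c → S a c
  S-trans = proj₂ (proj₁ S-associated)

  S-asym : ∀ {a b} → S a b → S b a → ⊥
  S-asym ab ba = proj₁ (proj₁ S-associated) refl (S-trans ab ba)

  S-compare : ∀ {u v} → ¬ E u v → S u v ⊎ S v u
  S-compare {u} {v} = proj₁ (proj₂ S-associated u v)

  S-apart : ∀ {u v} → S u v → ¬ E u v
  S-apart {u} {v} s = proj₂ (proj₂ S-associated u v) (inj₁ s)

  oriented-either : ∀ w → Oriented E S w ⊎ Oriented E S (flipW E-sym w)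
  oriented-either (_ , ¬ab) = S-compare ¬ab

  -- If Q joined (a , b) with S a b to (c , d) with S d c, then a c b d would be an
  -- induced 4-cycle; its edges cb and da are only obtained doubly negated.
  Q-preserves-orientation : ∀ {w w′} → Q E w w′ → Oriented E S w → Oriented E S w′
  Q-preserves-orientation {(a , b) , ¬ab} {(c , d) , ¬cd} (ac , bd) Sab
    with S-compare ¬cd
  ... | inj₁ Scd = Scd
  ... | inj₂ Sdc = ⊥-elim (¬¬cb λ cb → ¬¬da λ da → C4-free ac cb bd da ¬ab ¬cd)
    where
      ¬¬cb : ¬ ¬ E c b
      ¬¬cb ¬cb with S-compare ¬cb
      ... | inj₁ Scb = S-apart (S-trans Sdc Scb) (E-sym bd)
      ... | inj₂ Sbc = S-apart (S-trans Sab Sbc) ac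
      ¬¬da : ¬ ¬ E d a
      ¬¬da ¬da with S-compare ¬da
      ... | inj₁ Sda = S-apart (S-trans Sda Sab) (E-sym bd)
      ... | inj₂ Sad = S-apart (S-trans Sad Sdc) ac

  Connected-preserves-orientation :
    ∀ {w w′} → Connected E w w′ → Oriented E S w → Oriented E S w′
  Connected-preserves-orientation ε o = o
  Connected-preserves-orientation {w} (_◅_ {j = v} (fwd q) c) o =
    Connected-preserves-orientation c (Q-preserves-orientation {w} {v} q o)
  Connected-preserves-orientation {w} (_◅_ {j = v} (bwd (ca , db)) c) o =
    Connected-preserves-orientation c
      (Q-preserves-orientation {w} {v} (E-sym ca , E-sym db) o)

  flip-unreachable : ∀ w → ¬ Connected E w (flipW E-sym w)
  flip-unreachable w c with oriented-either w
  ... | inj₁ ab = S-asym ab (Connected-preserves-orientation c ab)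
  ... | inj₂ ba = S-asym ba (Connected-preserves-orientation (EqClosure.symmetric (Q E) c) ba)

module AtMostTwoComponents
  {V : Set} {E : Rel V 0ℓ} (E-sym : Symmetric E) (C4-free : InducedC4Free E)
  (w₁ w₂ : W E)
  (covered : ∀ w → Connected E w₁ w ⊎ Connected E w₂ w)
  where

  open AssociatedOrder {E = E} E-sym C4-free

  covered-by-w₁-or-flip : {S : Rel V 0ℓ} → IsAssociated E S →
    ∀ w → Connected E w₁ w ⊎ Connected E (flipW E-sym w₁) w
  covered-by-w₁-or-flip S-associated w with covered w | covered (flipW E-sym w₁)
  ... | inj₁ c₁ | _ = inj₁ c₁
  ... | inj₂ _  | inj₁ c₁ = ⊥-elim (flip-unreachable S-associated w₁ c₁)
  ... | inj₂ c₂ | inj₂ c₂′ =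
    inj₂ (EqClosure.transitive (Q E) (EqClosure.symmetric (Q E) c₂′) c₂)

  agree⇒⊆ : {R S : Rel V 0ℓ} → IsAssociated E R → IsAssociated E S →
    Oriented E R w₁ → Oriented E S w₁ → ∀ {u v} → S u v → R u v
  agree⇒⊆ R-associated S-associated R₁ S₁ {u} {v} s
    with covered-by-w₁-or-flip S-associated ((u , v) , S-apart S-associated s)
  ... | inj₁ c = Connected-preserves-orientation R-associated c R₁
  ... | inj₂ c = ⊥-elim (S-asym S-associated S₁
    (Connected-preserves-orientation S-associated (EqClosure.symmetric (Q E) c) s))

  agree⇒SameRel : {R S : Rel V 0ℓ} → IsAssociated E R → IsAssociated E S →
    Oriented E R w₁ → Oriented E S w₁ → SameRel R S
  agree⇒SameRel R-associated S-associated R₁ S₁ u v =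
    agree⇒⊆ S-associated R-associated S₁ R₁ , agree⇒⊆ R-associated S-associated R₁ S₁

  uniquely-orderable : {R : Rel V 0ℓ} → IsAssociated E R → UniquelyOrderable E
  uniquely-orderable {R} R-associated = R , R-associated , λ S S-associated →
    choose S-associated (oriented-either S-associated w₁) (oriented-either R-associated w₁)
    where
      R˘-associated : IsAssociated E (Dual R)
      R˘-associated = Dual-associated E-sym R-associated
      choose : ∀ {S} → IsAssociated E S →
        Oriented E S w₁ ⊎ Oriented E S (flipW E-sym w₁) →
        Oriented E R w₁ ⊎ Oriented E R (flipW E-sym w₁) →
        SameRel S R ⊎ SameRel S (Dual R)
      choose S-associated (inj₁ S₁) (inj₁ R₁) =
        inj₁ (agree⇒SameRel S-associated R-associated S₁ R₁)
      choose S-associated (inj₁ S₁) (inj₂ R₁) =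
        inj₂ (agree⇒SameRel S-associated R˘-associated S₁ R₁)
      choose S-associated (inj₂ S₁) (inj₁ R₁) =
        inj₂ (SameRel-swap (agree⇒SameRel (Dual-associated E-sym S-associated) R-associated S₁ R₁))
      -- Dual (Dual R) is R definitionally.
      choose S-associated (inj₂ S₁) (inj₂ R₁) =
        inj₁ (SameRel-swap (agree⇒SameRel (Dual-associated E-sym S-associated) R˘-associated S₁ R₁))

lemma3p5 : {V : Set} (E : Rel V 0ℓ) → IsGraph E → IsIntervalGraph E →
    ExactlyTwoComponents E → UniquelyOrderable E
lemma3p5 E E-sym (_ , L , _ , intervals , represents) (w₁ , w₂ , _ , covered) =
  uniquely-orderable ≺-associated
  where
    open IntervalOrder E-sym L intervals represents
    open AtMostTwoComponents E-sym inducedC4Free w₁ w₂ covered
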